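{- Let $k\ge3$ be an odd integer, and let $A$ be a cyclically $k$-diagonal array of size $n>k$ in standard form. Let $R=(1,\dots,1)$, and let $C\in\{ -1,1\}^n$ have its entries $-1$ exactly in positions $E=(e_1,\dots,e_t)$, with $e_1<\dots<e_t$. Then $R$ and $C$ are a solution of $P(A)$ if and only if both of the following hold: 1) with $d=\gcd(n,k-1)$, the list $E$ covers all congruence classes modulo $d$; 2) the permutation $\omega_{2,C}\circ\omega_{1,C}$ of $E$ is a cycle of length $t$.
   Context: Arrays are toroidal: an $n\times n$ array has rows and columns indexed modulo $n$ (representatives $1,\dots,n$). Each cell is filled or empty; $F(A)$ is the set of filled cells. For $(i,j)\in F(A)$: - the row successor $s_r((i,j))$ is $(i,j+k)$ with $k\ge1$ minimal such that $(i,j+k)\in F(A)$; - the column successor $s_c((i,j))$ is $(i+k,j)$ with $k\ge1$ minimal such that $(i+k,j)\in F(A)$. Given $R,C\in\{ -1,1\}^n$, the move function is $S_{R,C}((i,j))=s_c^{\,c_{j'}}((i,j'))$, where $(i,j')=s_r^{\,r_i}((i,j))$; exponent $-1$ means inverse. $R,C$ is a solution of $P(A)$ if $S_{R,C}$ is a single cycle on $F(A)$. Diagonals: $D_i=\{(i+t-1,t):t=1,\dots,n\}$, with row indices modulo $n$. A square array of size $n>k$ is cyclically $k$-diagonal if its filled cells are exactly those of $k$ diagonals consecutive modulo $n$. It is in standard form if the filled diagonals are $D_1,\dots,D_k$. "$E$ covers all congruence classes modulo $d$" means every residue modulo $d$ is congruent to some element of $E$. Permutations of $E$: - For $e\in E$,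 $\omega_{1,C}(e)=e''$, where $m\ge1$ is minimal such that $e-m(k-1)\equiv e''\pmod n$ for some $e''\in E$. - $\omega_{2,C}(e_i)=e_{i+(k-1)}$, with the index taken modulo $t$. -}

module Defs where

open import Data.Bool using (Bool; true; false; if_then_else_; T)
open import Data.Nat using (ℕ; zero; suc; _+_; _*_; _∸_; _≡ᵇ_; NonZero)
open import Data.Nat.DivMod using (_%_; _mod_)
open import Data.Fin using (Fin; toℕ)
open import Data.List using (List; []; _∷_; map; length; lookup; filterᵇ; upTo; allFin; findIndexᵇ)
open import Data.Bool.ListAction using (any)
open import Data.List.Relation.Unary.Any using (Any)
open import Data.Maybe using (Maybe; just; nothing; fromMaybe)
open import Data.Product using (_×_; _,_; ∃)
open import Data.Sign using (Sign) renaming (+ to plus; - to minus)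
open import Data.Integer using (ℤ; +_; _-_)
open import Data.Integer.Divisibility using (_∣_)
open import Relation.Binary.PropositionalEquality using (_≡_)

iter : {A : Set} → (A → A) → ℕ → A → A
iter f zero    x = x
iter f (suc m) x = f (iter f m x)

IsFullCycle : {A : Set} → (A → A) → Set
IsFullCycle {A} π = (x y : A) → ∃ λ m → iter π m x ≡ y

search : {B : Set} → ℕ → ℕ → (ℕ → Maybe B) → Maybe B
search zero       m f = nothing
search (suc fuel) m f with f m
... | just b  = just b
... | nothing = search fuel (suc m) f

-- Toroidal n×n arrays; rows/columns indexed by Fin n (representative toℕ i + 1).
Array : ℕ → Set
Array n = Fin n → Fin n → Bool

Cell : ℕ → Set
Cell n = Fin n × Fin n

Filled : {n : ℕ} → Array n → Cell n → Set
Filled A (i , j) = T (A i j)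

-- Diagonal D_a (a = 1..n): cells (a + t - 1, t).  With 0-based representatives
-- (row i, column j), the cell lies on D_a iff i ≡ (a - 1) + j (mod n).
stdDiagArray : (n k : ℕ) .{{_ : NonZero n}} → Array n
stdDiagArray n k i j = any (λ a → ((a + toℕ j) % n) ≡ᵇ toℕ i) (upTo k)

module _ {n : ℕ} .{{_ : NonZero n}} (A : Array n) where

  rowSucc : Cell n → Cell n
  rowSucc (i , j) = i , fromMaybe j (search n 1 λ m →
    let c = (toℕ j + m) mod n in if A i c then just c else nothing)

  rowPred : Cell n → Cell n
  rowPred (i , j) = i , fromMaybe j (search n 1 λ m →
    let c = (toℕ j + (n ∸ m)) mod n in if A i c then just c else nothing)

  colSucc : Cell n → Cell n
  colSucc (i , j) = fromMaybe i (search n 1 λ m →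
    let r = (toℕ i + m) mod n in if A r j then just r else nothing) , j

  colPred : Cell n → Cell n
  colPred (i , j) = fromMaybe i (search n 1 λ m →
    let r = (toℕ i + (n ∸ m)) mod n in if A r j then just r else nothing) , j

  rowStep : Sign → Cell n → Cell n
  rowStep plus  = rowSucc
  rowStep minus = rowPred

  colStep : Sign → Cell n → Cell n
  colStep plus  = colSucc
  colStep minus = colPred

  move : (R C : Fin n → Sign) → Cell n → Cell n
  move R C (i , j) with rowStep (R i) (i , j)
  ... | (i' , j') = colStep (C j') (i' , j')

  IsSolution : (R C : Fin n → Sign) → Set
  IsSolution R C = (x y : Cell n) → Filled A x → Filled A y →
                   ∃ λ m → iter (move R C) m x ≡ y

allPlus : (n : ℕ) → Fin n → Sign
allPlus n _ = plus

isMinus : Sign → Bool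
isMinus minus = true
isMinus plus  = false

-- E = (e_1 < ... < e_t): the positions (1-based) where C has entry -1, increasing
minusPositions : {n : ℕ} → (Fin n → Sign) → List ℕ
minusPositions {n} C = map (λ j → suc (toℕ j)) (filterᵇ (λ j → isMinus (C j)) (allFin n))

_≡_[mod_] : ℕ → ℕ → ℕ → Set
a ≡ b [mod d ] = (+ d) ∣ ((+ a) - (+ b))

CoversClasses : List ℕ → ℕ → Set
CoversClasses E d = (r : ℕ) → Any (λ e → e ≡ r [mod d ]) E

-- ω_{1,C}, acting on indices of E:  e_i ↦ e'' where m ≥ 1 is minimal such that
-- e_i - m(k-1) ≡ e'' (mod n) for some e'' ∈ E  (i.e. e'' + m(k-1) ≡ e_i (mod n)).
ω₁ : (n k : ℕ) .{{_ : NonZero n}} (E : List ℕ) → Fin (length E) → Fin (length E)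
ω₁ n k E i = fromMaybe i (search n 1 λ m →
  findIndexᵇ (λ e'' → ((e'' + m * (k ∸ 1)) % n) ≡ᵇ (lookup E i % n)) E)

shiftIdx : (t a : ℕ) → Fin t → Fin t
shiftIdx (suc t) a i = (toℕ i + a) mod (suc t)

ω₂ : (k : ℕ) (E : List ℕ) → Fin (length E) → Fin (length E)
ω₂ k E = shiftIdx (length E) (k ∸ 1)

module Submission where

-- Write k = 2h+3, n = k + p + 1 and w = n - (k-1).  A filled cell is
-- encoded as (j , a): column j and level a (diagonal D_{a+1}, row j + a).
-- Under this encoding S_{R,C} becomes an explicit map `step`: from level 0
-- it moves w columns right, from other levels one column; in a minus column
-- the level drops (a+2 ↦ a, 1 ↦ k-1, 0 ↦ k-2), in a plus column it stays.
-- Call the level-0 cells of minus columns hubs.  From the hub of the minus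
-- column e, jumps lead to ω₁(e) at level k-2 and then k-1 segments (walks
-- to the next minus column) lead to the hub of ω₂(ω₁(e)), meeting no hub in
-- between.  Jumps preserve the column class modulo d and reach every column
-- of that class.
--   Necessity: a level-0 cell in an uncovered class never leaves level 0;
-- an orbit joining two hubs passes through the hubs in the order of ω₂ ∘ ω₁.
--   Sufficiency: with full coverage every cell reaches a hub, the hubs are
-- joined through ω₂ ∘ ω₁, and `step` is a permutation of a finite set, so
-- reachability is symmetric.

open import Defs
open import Data.Bool using (Bool; true; false; if_then_else_; T)
open import Data.Bool.ListAction using (any)
open import Data.Empty using (⊥-elim)
open import Data.Fin using (Fin; toℕ; fromℕ<) renaming (zero to fz; suc to fs)
open import Data.Fin.Properties using (toℕ-fromℕ<; toℕ-injective; toℕ<n; pigeonhole; fromℕ<-injective)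
open import Data.Integer using (∣_∣) renaming (+_ to ⁺; _-_ to _-ℤ_)
import Data.Integer.Properties as ℤ
open import Data.List using (List; _∷_; length; lookup; findIndexᵇ; applyUpTo)
open import Data.List.Membership.Propositional using (_∈_; lose)
open import Data.List.Membership.Propositional.Properties using (∈-map⁺; ∈-map⁻; ∈-filter⁺; ∈-filter⁻; ∈-lookup; ∈-allFin)
import Data.List.Relation.Unary.All as All
open import Data.List.Relation.Unary.AllPairs using (AllPairs; _∷_)
import Data.List.Relation.Unary.AllPairs.Properties as AllPairs
open import Data.List.Relation.Unary.Any using (Any; index; any?)
open import Data.List.Relation.Unary.Any.Properties using (lookup-index)
open import Data.Maybe using (Maybe; just; nothing; fromMaybe)
open import Data.Nat
open import Data.Nat.DivMod
open import Data.Nat.Divisibility using (divides; ∣m+n∣m⇒∣n; _∣?_) renaming (_∣_ to _∣ℕ_)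
open import Data.Nat.GCD using (gcd; gcd-GCD; gcd[m,n]∣m; gcd[m,n]∣n; gcd[m,n]≢0; module Bézout)
open import Data.Nat.Properties
open import Data.Nat.Tactic.RingSolver using (solve-∀)
open import Data.Product using (_×_; _,_; ∃; Σ; proj₁; proj₂)
open import Data.Sign using (Sign) renaming (+ to plus; - to minus)
open import Data.Sum using (_⊎_; inj₁; inj₂)
open import Data.Unit using (⊤; tt)
open import Function using (_∘_)
open import Function.Bundles using (_⇔_; mk⇔)
open import Relation.Binary.Definitions using (tri<; tri≈; tri>)
open import Relation.Binary.PropositionalEquality
open import Relation.Nullary using (¬_; yes; no)
open import Relation.Nullary.Decidable using (T?)

Reaches : {A : Set} → (A → A) → A → A → Set
Reaches f x y = ∃ λ m → iter f m x ≡ y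

iter-+ : ∀ {A : Set} (f : A → A) a b x → iter f (a + b) x ≡ iter f a (iter f b x)
iter-+ f zero    b x = refl
iter-+ f (suc a) b x = cong f (iter-+ f a b x)

iter-suc-inner : ∀ {A : Set} (f : A → A) m x → iter f (suc m) x ≡ iter f m (f x)
iter-suc-inner f m x = trans (cong (λ z → iter f z x) (+-comm 1 m)) (iter-+ f m 1 x)

reaches-trans : ∀ {A : Set} {f : A → A} {x y z} → Reaches f x y → Reaches f y z → Reaches f x z
reaches-trans {f = f} {x} (a , ea) (b , eb) =
  b + a , trans (iter-+ f b a x) (trans (cong (iter f b) ea) eb)

iter-preserves : ∀ {A : Set} (f : A → A) (P : A → Set) → (∀ {x} → P x → P (f x)) →
  ∀ m {x} → P x → P (iter f m x)
iter-preserves f P pres zero    px = px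
iter-preserves f P pres (suc m) px = pres (iter-preserves f P pres m px)

-- An injective self-map of a finite set (the elements satisfying Valid, coded
-- injectively into {0,…,N-1}) is a permutation: every point is periodic and
-- reachability is symmetric.
module FinitePermutation {A : Set} (f : A → A) (Valid : A → Set)
  (f-valid : ∀ {x} → Valid x → Valid (f x))
  (f-injective : ∀ {x y} → Valid x → Valid y → f x ≡ f y → x ≡ y)
  (N : ℕ) (code : A → ℕ) (code< : ∀ {x} → Valid x → code x < N)
  (code-injective : ∀ {x y} → Valid x → Valid y → code x ≡ code y → x ≡ y) where

  iter-valid : ∀ m {x} → Valid x → Valid (iter f m x)
  iter-valid = iter-preserves f Valid f-valid

  iter-injective : ∀ m {x y} → Valid x → Valid y → iter f m x ≡ iter f m y → x ≡ y
  iter-injective zero    vx vy e = e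
  iter-injective (suc m) vx vy e =
    iter-injective m vx vy (f-injective (iter-valid m vx) (iter-valid m vy) e)

  -- pigeonhole on the first N+1 iterates, then cancel the common prefix
  periodic : ∀ {x} → Valid x → ∃ λ P → 1 ≤ P × iter f P x ≡ x
  periodic {x} vx with pigeonhole (n<1+n N) (λ i → fromℕ< (code< (iter-valid (toℕ i) vx)))
  ... | i , i' , i<i' , same-code = P , m<n⇒0<n∸m i<i' , sym (iter-injective (toℕ i) vx (iter-valid P vx) shifted)
    where
    P = toℕ i' ∸ toℕ i
    same : iter f (toℕ i) x ≡ iter f (toℕ i') x
    same = code-injective (iter-valid (toℕ i) vx) (iter-valid (toℕ i') vx) (fromℕ<-injective _ _ _ _ same-code)
    shifted : iter f (toℕ i) x ≡ iter f (toℕ i) (iter f P x)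
    shifted = trans same (trans (cong (λ z → iter f z x) (sym (trans (+-comm (toℕ i) P) (m∸n+n≡m (<⇒≤ i<i')))))
                                (iter-+ f (toℕ i) P x))

  -- if x reaches y in m steps, y returns to x after m·P - m further steps
  reaches-sym : ∀ {x y} → Valid x → Reaches f x y → Reaches f y x
  reaches-sym {x} vx (m , refl) with periodic vx
  ... | P , 1≤P , eP = m * P ∸ m , (begin
      iter f (m * P ∸ m) (iter f m x) ≡⟨ iter-+ f (m * P ∸ m) m x ⟨
      iter f (m * P ∸ m + m) x        ≡⟨ cong (λ z → iter f z x) (m∸n+n≡m m≤m*P) ⟩
      iter f (m * P) x                ≡⟨ multiple m ⟩
      x                               ∎)
    where
    open ≡-Reasoning
    m≤m*P : m ≤ m * P
    m≤m*P = subst (_≤ m * P) (*-identityʳ m) (*-monoʳ-≤ m 1≤P)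
    multiple : ∀ c → iter f (c * P) x ≡ x
    multiple zero    = refl
    multiple (suc c) = trans (iter-+ f P (c * P) x) (trans (cong (iter f P) (multiple c)) eP)

search-first-hit : ∀ {B : Set} fuel s (f : ℕ → Maybe B) q {b} →
  (∀ u → u < q → f (s + u) ≡ nothing) → f (s + q) ≡ just b → q < fuel → search fuel s f ≡ just b
search-first-hit (suc fuel) s f zero    miss hit _ with f s in eq
... | just _  = trans (sym eq) (trans (cong f (sym (+-identityʳ s))) hit)
... | nothing with () ← trans (sym eq) (trans (cong f (sym (+-identityʳ s))) hit)
search-first-hit (suc fuel) s f (suc q) miss hit (s≤s q<fuel) with f s in eq
... | just _ with () ← trans (sym eq) (trans (cong f (sym (+-identityʳ s))) (miss 0 (s≤s z≤n)))
... | nothing = search-first-hit fuel (suc s) f q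
      (λ u u<q → trans (cong f (sym (+-suc s u))) (miss (suc u) (s≤s u<q)))
      (trans (cong f (sym (+-suc s q))) hit) q<fuel

search-success : ∀ {B : Set} fuel s (f : ℕ → Maybe B) {b} → search fuel s f ≡ just b →
  ∃ λ u → u < fuel × f (s + u) ≡ just b × (∀ u' → u' < u → f (s + u') ≡ nothing)
search-success (suc fuel) s f {b} found with f s in eq
... | just _ = 0 , s≤s z≤n , trans (cong f (+-identityʳ s)) (trans eq found) , λ _ ()
... | nothing with search-success fuel (suc s) f found
... | u , u<fuel , hit , before = suc u , s≤s u<fuel , trans (cong f (+-suc s u)) hit , earlier
  where
  earlier : ∀ u' → u' < suc u → f (s + u') ≡ nothing
  earlier zero     _          = trans (cong f (+-identityʳ s)) eq
  earlier (suc u') (s≤s u'<u) = trans (cong f (+-suc s u')) (before u' u'<u)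

search-failure : ∀ {B : Set} fuel s (f : ℕ → Maybe B) → search fuel s f ≡ nothing →
  ∀ u → u < fuel → f (s + u) ≡ nothing
search-failure (suc fuel) s f failed u u<fuel with f s in eq
search-failure (suc fuel) s f () u u<fuel | just _
search-failure (suc fuel) s f failed zero    _            | nothing = trans (cong f (+-identityʳ s)) eq
search-failure (suc fuel) s f failed (suc u) (s≤s u<fuel) | nothing =
  trans (cong f (+-suc s u)) (search-failure fuel (suc s) f failed u u<fuel)

findIndexᵇ-just : ∀ {A : Set} (p : A → Bool) (xs : List A) {i} → findIndexᵇ p xs ≡ just i → p (lookup xs i) ≡ true
findIndexᵇ-just p (x ∷ xs) {i} found with p x in px
findIndexᵇ-just p (x ∷ xs) {fz}   found | true = px
findIndexᵇ-just p (x ∷ xs) {fs i} ()    | true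
... | false with findIndexᵇ p xs in rest
findIndexᵇ-just p (x ∷ xs) {fs i} refl | false | just .i = findIndexᵇ-just p xs rest
findIndexᵇ-just p (x ∷ xs) {i}    ()   | false | nothing

findIndexᵇ-nothing : ∀ {A : Set} (p : A → Bool) (xs : List A) → findIndexᵇ p xs ≡ nothing → ∀ i → p (lookup xs i) ≡ false
findIndexᵇ-nothing p (x ∷ xs) none i with p x in px
findIndexᵇ-nothing p (x ∷ xs) () i | true
... | false with findIndexᵇ p xs in rest
findIndexᵇ-nothing p (x ∷ xs) ()   i      | false | just _
findIndexᵇ-nothing p (x ∷ xs) refl fz     | false | nothing = px
findIndexᵇ-nothing p (x ∷ xs) refl (fs i) | false | nothing = findIndexᵇ-nothing p xs rest i

any-applyUpTo⁺ : ∀ {A : Set} (f : A → Bool) (g : ℕ → A) k a → a < k → f (g a) ≡ true → any f (applyUpTo g k) ≡ true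
any-applyUpTo⁺ f g (suc k) zero    _         fa rewrite fa = refl
any-applyUpTo⁺ f g (suc k) (suc a) (s≤s a<k) fa with f (g 0)
... | true  = refl
... | false = any-applyUpTo⁺ f (g ∘ suc) k a a<k fa

any-applyUpTo⁻ : ∀ {A : Set} (f : A → Bool) (g : ℕ → A) k → any f (applyUpTo g k) ≡ true → ∃ λ a → a < k × f (g a) ≡ true
any-applyUpTo⁻ f g (suc k) found with f (g 0) in e
... | true  = 0 , s≤s z≤n , e
... | false with any-applyUpTo⁻ f (g ∘ suc) k found
... | a , a<k , fa = suc a , s≤s a<k , fa

if-true : ∀ {B : Set} {b} (x : B) → b ≡ true → (if b then just x else nothing) ≡ just x
if-true x refl = refl

if-false : ∀ {B : Set} {b} (x : B) → b ≡ false → (if b then just x else nothing) ≡ nothing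
if-false x refl = refl

≡ᵇ-refl : ∀ m → (m ≡ᵇ m) ≡ true
≡ᵇ-refl zero    = refl
≡ᵇ-refl (suc m) = ≡ᵇ-refl m

≡ᵇ-sound : ∀ m n → (m ≡ᵇ n) ≡ true → m ≡ n
≡ᵇ-sound m n e = ≡ᵇ⇒≡ m n (subst T (sym e) tt)

T⇒≡true : ∀ {b} → T b → b ≡ true
T⇒≡true {true} _ = refl

≡true⇒T : ∀ {b} → b ≡ true → T b
≡true⇒T refl = tt

true≢false : true ≢ false
true≢false ()

AllPairs-lookup : ∀ {A : Set} {R : A → A → Set} {xs : List A} → AllPairs R xs →
  ∀ (i j : Fin (length xs)) → toℕ i < toℕ j → R (lookup xs i) (lookup xs j)
AllPairs-lookup (px ∷ _)   fz     (fs j) _         = All.lookup px (∈-lookup j)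
AllPairs-lookup (_  ∷ pxs) (fs i) (fs j) (s≤s i<j) = AllPairs-lookup pxs i j i<j

move-unfold : ∀ {n : ℕ} .{{_ : NonZero n}} (A : Array n) R C (i j : Fin n) →
  move A R C (i , j) ≡ colStep A (C (proj₂ (rowStep A (R i) (i , j)))) (rowStep A (R i) (i , j))
move-unfold A R C i j with rowStep A (R i) (i , j)
... | _ = refl

∣⁺a-⁺b∣-≥ : ∀ a b → b ≤ a → ∣ ⁺ a -ℤ ⁺ b ∣ ≡ a ∸ b
∣⁺a-⁺b∣-≥ a b b≤a = trans (cong ∣_∣ (ℤ.m-n≡m⊖n a b)) (cong ∣_∣ (ℤ.⊖-≥ b≤a))

∣⁺a-⁺b∣-≤ : ∀ a b → a ≤ b → ∣ ⁺ a -ℤ ⁺ b ∣ ≡ b ∸ a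
∣⁺a-⁺b∣-≤ a b a≤b = trans (cong ∣_∣ (ℤ.m-n≡m⊖n a b)) (ℤ.∣⊖∣-≤ a≤b)

∣∸⇒≡+* : ∀ {d a b} → b ≤ a → d ∣ℕ (a ∸ b) → ∃ λ u → a ≡ b + u * d
∣∸⇒≡+* {b = b} b≤a (divides u eq) = u , trans (sym (m+[n∸m]≡n b≤a)) (cong (b +_) eq)

≡%⇒∣∸ : ∀ d .{{_ : NonZero d}} a b → a % d ≡ b % d → d ∣ℕ (a ∸ b)
≡%⇒∣∸ d a b e = divides (a / d ∸ b / d) (begin
  a ∸ b                                     ≡⟨ cong₂ _∸_ (m≡m%n+[m/n]*n a d) (m≡m%n+[m/n]*n b d) ⟩
  (a % d + a / d * d) ∸ (b % d + b / d * d) ≡⟨ cong (λ z → (z + a / d * d) ∸ (b % d + b / d * d)) e ⟩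
  (b % d + a / d * d) ∸ (b % d + b / d * d) ≡⟨ [m+n]∸[m+o]≡n∸o (b % d) _ _ ⟩
  a / d * d ∸ b / d * d                     ≡⟨ *-distribʳ-∸ d (a / d) (b / d) ⟨
  (a / d ∸ b / d) * d                       ∎)
  where open ≡-Reasoning

≡%⇒≡[mod] : ∀ d .{{_ : NonZero d}} a b → a % d ≡ b % d → a ≡ b [mod d ]
≡%⇒≡[mod] d a b e with ≤-total b a
... | inj₁ b≤a = subst (d ∣ℕ_) (sym (∣⁺a-⁺b∣-≥ a b b≤a)) (≡%⇒∣∸ d a b e)
... | inj₂ a≤b = subst (d ∣ℕ_) (sym (∣⁺a-⁺b∣-≤ a b a≤b)) (≡%⇒∣∸ d b a (sym e))

module Congruence (n' : ℕ) where

  n : ℕ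
  n = suc n'

  record _≋_ (a b : ℕ) : Set where
    constructor mk≋
    field un≋ : a % n ≡ b % n
  open _≋_ public
  infix 4 _≋_

  ≋-refl : ∀ {a} → a ≋ a
  ≋-refl = mk≋ refl

  ≡⇒≋ : ∀ {a b} → a ≡ b → a ≋ b
  ≡⇒≋ e = mk≋ (cong (_% n) e)

  ≋-sym : ∀ {a b} → a ≋ b → b ≋ a
  ≋-sym (mk≋ e) = mk≋ (sym e)

  ≋-trans : ∀ {a b c} → a ≋ b → b ≋ c → a ≋ c
  ≋-trans (mk≋ e) (mk≋ f) = mk≋ (trans e f)

  ≋-% : ∀ a → a % n ≋ a
  ≋-% a = mk≋ (m%n%n≡m%n a n)

  ≋-+ : ∀ {a b c d} → a ≋ b → c ≋ d → a + c ≋ b + d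
  ≋-+ {a} {b} {c} {d} (mk≋ e1) (mk≋ e2) =
    mk≋ (trans (%-distribˡ-+ a c n) (trans (cong₂ (λ x y → (x + y) % n) e1 e2) (sym (%-distribˡ-+ b d n))))

  ≋-+ˡ : ∀ {a b} c → a ≋ b → c + a ≋ c + b
  ≋-+ˡ c e = ≋-+ (≋-refl {c}) e

  ≋-+ʳ : ∀ {a b} c → a ≋ b → a + c ≋ b + c
  ≋-+ʳ c e = ≋-+ e (≋-refl {c})

  ≋-+*n : ∀ a q → a + q * n ≋ a
  ≋-+*n a q = mk≋ ([m+kn]%n≡m%n a q n)

  ≋-+n : ∀ a → a + n ≋ a
  ≋-+n a = ≋-trans (≡⇒≋ (cong (a +_) (sym (+-identityʳ n)))) (≋-+*n a 1)

  -- adding c is undone by adding (n-1)·c, since c + (n-1)·c = c·n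
  ≋-cancelʳ : ∀ {a b} c → a + c ≋ b + c → a ≋ b
  ≋-cancelʳ {a} {b} c e =
    ≋-trans (≋-sym (≋-+*n a c)) (≋-trans (≡⇒≋ (regroup a)) (≋-trans (≋-+ʳ (n' * c) e)
      (≋-trans (≡⇒≋ (sym (regroup b))) (≋-+*n b c))))
    where
    regroup : ∀ x → x + c * n ≡ (x + c) + n' * c
    regroup x = trans (cong (x +_) (*-comm c n)) (sym (+-assoc x c (n' * c)))

  ≋-cancelˡ : ∀ {a b} c → c + a ≋ c + b → a ≋ b
  ≋-cancelˡ {a} {b} c e = ≋-cancelʳ c (≋-trans (≡⇒≋ (+-comm a c)) (≋-trans e (≡⇒≋ (+-comm c b))))

  ≋⇒≡ : ∀ {a b} → a < n → b < n → a ≋ b → a ≡ b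
  ≋⇒≡ {a} {b} a<n b<n (mk≋ e) = trans (sym (m<n⇒m%n≡m a<n)) (trans e (m<n⇒m%n≡m b<n))

  %<n : ∀ a → a % n < n
  %<n a = m%n<n a n

  toℕ-mod : ∀ m → toℕ (m mod n) ≡ m % n
  toℕ-mod m = toℕ-fromℕ< (m%n<n m n)

  toℕ-mod-≋ : ∀ m → toℕ (m mod n) ≋ m
  toℕ-mod-≋ m = ≋-trans (≡⇒≋ (toℕ-mod m)) (≋-% m)

  mod-toℕ : ∀ (x : Fin n) → toℕ x mod n ≡ x
  mod-toℕ x = toℕ-injective (trans (toℕ-mod (toℕ x)) (m<n⇒m%n≡m (toℕ<n x)))

  mod-cong : ∀ {a b} → a ≋ b → a mod n ≡ b mod n
  mod-cong {a} {b} (mk≋ e) = toℕ-injective (trans (toℕ-mod a) (trans e (sym (toℕ-mod b))))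

  cell : ℕ × ℕ → Cell n
  cell (r , c) = r mod n , c mod n

  cell-cong : ∀ {r r' c c'} → r ≋ r' → c ≋ c' → cell (r , c) ≡ cell (r' , c')
  cell-cong e1 e2 = cong₂ _,_ (mod-cong e1) (mod-cong e2)

[m%d+a]%d≡[m+a]%d : ∀ m a d .{{_ : NonZero d}} → (m % d + a) % d ≡ (m + a) % d
[m%d+a]%d≡[m+a]%d m a d = trans (%-distribˡ-+ (m % d) a d)
  (trans (cong (λ z → (z + a % d) % d) (m%n%n≡m%n m d)) (sym (%-distribˡ-+ m a d)))

shiftIdx-+ : ∀ t a b (i : Fin t) → shiftIdx t a (shiftIdx t b i) ≡ shiftIdx t (b + a) i
shiftIdx-+ (suc t) a b i = toℕ-injective (begin
  toℕ (shiftIdx (suc t) a (shiftIdx (suc t) b i)) ≡⟨ toℕ-fromℕ< _ ⟩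
  (toℕ ((toℕ i + b) mod suc t) + a) % suc t      ≡⟨ cong (λ z → (z + a) % suc t) (toℕ-fromℕ< (m%n<n (toℕ i + b) (suc t))) ⟩
  ((toℕ i + b) % suc t + a) % suc t              ≡⟨ [m%d+a]%d≡[m+a]%d (toℕ i + b) a (suc t) ⟩
  (toℕ i + b + a) % suc t                        ≡⟨ cong (_% suc t) (+-assoc (toℕ i) b a) ⟩
  (toℕ i + (b + a)) % suc t                      ≡⟨ toℕ-fromℕ< _ ⟨
  toℕ (shiftIdx (suc t) (b + a) i)               ∎)
  where open ≡-Reasoning

shiftIdx-1-inner : ∀ t (i : Fin t) → suc (toℕ i) < t → toℕ (shiftIdx t 1 i) ≡ suc (toℕ i)
shiftIdx-1-inner (suc t) i lt = trans (toℕ-fromℕ< _) (trans (cong (_% suc t) (+-comm (toℕ i) 1)) (m<n⇒m%n≡m lt))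

shiftIdx-1-last : ∀ t (i : Fin t) → suc (toℕ i) ≡ t → toℕ (shiftIdx t 1 i) ≡ 0
shiftIdx-1-last (suc t) i eq = trans (toℕ-fromℕ< _) (trans (cong (_% suc t) (trans (+-comm (toℕ i) 1) eq)) (n%n≡0 (suc t)))

-- The geometry of the standard array with k = 2h+3 diagonals and n = k+p+1.
-- A cell (r , c) lies on level L (diagonal D_{L+1}) when r ≡ L + c; the
-- filled cells are those of level < k.  The four neighbour maps are computed
-- explicitly: inside the k filled levels they move by one, across the band
-- of p+1 empty levels they jump.
module Geometry (h p : ℕ) where

  k1 k2 k w n' : ℕ
  k1 = suc (suc (h + h))   -- k - 1
  k2 = suc (h + h)         -- k - 2
  k  = suc k1
  w  = suc (suc p)         -- n - (k - 1): width of the empty band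
  n' = k1 + suc p

  open Congruence n' public

  k1+w≡n : k1 + w ≡ n
  k1+w≡n = +-suc k1 (suc p)

  k<n : k < n
  k<n = m<m+n k (s≤s z≤n)

  A : Array n
  A = stdDiagArray n k

  OnLevel : ℕ → ℕ → ℕ → Set
  OnLevel L r c = L + c ≋ r

  filled-level : ∀ {L r c} → L < k → OnLevel L r c → A (r mod n) (c mod n) ≡ true
  filled-level {L} {r} {c} L<k on = any-applyUpTo⁺ (λ a → ((a + toℕ (c mod n)) % n) ≡ᵇ toℕ (r mod n)) (λ x → x) k L L<k
    (subst (λ z → ((L + toℕ (c mod n)) % n ≡ᵇ z) ≡ true) e (≡ᵇ-refl ((L + toℕ (c mod n)) % n)))
    where
    e : (L + toℕ (c mod n)) % n ≡ toℕ (r mod n)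
    e = trans (un≋ (≋-+ˡ L (toℕ-mod-≋ c))) (trans (un≋ on) (sym (toℕ-mod r)))

  empty-level : ∀ {L r c} → k ≤ L → L < n → OnLevel L r c → A (r mod n) (c mod n) ≡ false
  empty-level {L} {r} {c} k≤L L<n on with A (r mod n) (c mod n) in eq
  ... | false = refl
  ... | true with any-applyUpTo⁻ (λ a → ((a + toℕ (c mod n)) % n) ≡ᵇ toℕ (r mod n)) (λ x → x) k eq
  ... | a , a<k , fa = ⊥-elim (<⇒≱ a<k (subst (k ≤_) (sym a≡L) k≤L))
    where
    same : a + c ≋ L + c
    same = ≋-trans (≋-+ˡ a (≋-sym (toℕ-mod-≋ c)))
             (≋-trans (mk≋ (trans (≡ᵇ-sound _ _ fa) (toℕ-mod r))) (≋-sym on))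
    a≡L : a ≡ L
    a≡L = ≋⇒≡ (<-≤-trans a<k (≤-trans k≤L (<⇒≤ L<n))) L<n (≋-cancelʳ c same)

  band-level : ∀ u → u < suc p → k ≤ n ∸ suc u
  band-level u u<sp = subst (k ≤_) (sym (+-∸-assoc k u<sp)) (m≤m+n k (suc p ∸ suc u))

  band-level<n : ∀ u → n ∸ suc u < n
  band-level<n u = s≤s (m∸n≤m n' u)

  n∸m+[x+m] : ∀ x m → m ≤ n → (n ∸ m) + (x + m) ≡ x + n
  n∸m+[x+m] x m m≤n = trans (cong ((n ∸ m) +_) (+-comm x m)) (trans (sym (+-assoc (n ∸ m) m x))
    (trans (cong (_+ x) (m∸n+n≡m m≤n)) (+-comm n x)))

  n∸w≡k1 : n ∸ w ≡ k1
  n∸w≡k1 = trans (cong (_∸ w) (sym k1+w≡n)) (m+n∸n≡m k1 w)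

  rowSearch colSearch colPredSearch : ℕ → ℕ → ℕ → Maybe (Fin n)
  rowSearch r c m = if A (r mod n) ((toℕ (c mod n) + m) mod n) then just ((toℕ (c mod n) + m) mod n) else nothing
  colSearch r c m = if A ((toℕ (r mod n) + m) mod n) (c mod n) then just ((toℕ (r mod n) + m) mod n) else nothing
  colPredSearch r c m = if A ((toℕ (r mod n) + (n ∸ m)) mod n) (c mod n) then just ((toℕ (r mod n) + (n ∸ m)) mod n) else nothing

  rowSucc-upper : ∀ {L r c} → suc L < k → OnLevel (suc L) r c → rowSucc A (cell (r , c)) ≡ cell (r , suc c)
  rowSucc-upper {L} {r} {c} sL<k on =
    cong (r mod n ,_) (trans (cong (fromMaybe (c mod n)) (search-first-hit n 1 (rowSearch r c) 0 (λ _ ()) hit (s≤s z≤n))) (mod-cong e))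
    where
    e : toℕ (c mod n) + 1 ≋ suc c
    e = ≋-trans (≋-+ʳ 1 (toℕ-mod-≋ c)) (≡⇒≋ (+-comm c 1))
    on' : OnLevel L r (toℕ (c mod n) + 1)
    on' = ≋-trans (≋-+ˡ L e) (≋-trans (≡⇒≋ (+-suc L c)) on)
    hit : rowSearch r c 1 ≡ just ((toℕ (c mod n) + 1) mod n)
    hit = if-true _ (filled-level (<-trans ≤-refl sL<k) on')

  rowSucc-level0 : ∀ {r c} → OnLevel 0 r c → rowSucc A (cell (r , c)) ≡ cell (r , c + w)
  rowSucc-level0 {r} {c} on =
    cong (r mod n ,_) (trans (cong (fromMaybe (c mod n)) (search-first-hit n 1 (rowSearch r c) (suc p) miss hit (m<n+m (suc p) {k} (s≤s z≤n)))) (mod-cong (≋-+ʳ w (toℕ-mod-≋ c))))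
    where
    x = toℕ (c mod n)
    x≋r : x + n ≋ r
    x≋r = ≋-trans (≋-+n x) (≋-trans (toℕ-mod-≋ c) on)
    miss : ∀ u → u < suc p → rowSearch r c (1 + u) ≡ nothing
    miss u u<sp = if-false _ (empty-level (band-level u u<sp) (band-level<n u)
      (≋-trans (≡⇒≋ (n∸m+[x+m] x (suc u) (≤-trans u<sp (m≤n+m (suc p) k)))) x≋r))
    hit : rowSearch r c (1 + suc p) ≡ just ((x + w) mod n)
    hit = if-true _ (filled-level ≤-refl (≋-trans (≡⇒≋ (trans (+-comm k1 (x + w))
      (trans (+-assoc x w k1) (cong (x +_) (trans (+-comm w k1) k1+w≡n))))) x≋r))

  colSucc-inner : ∀ {L r c} → suc L < k → OnLevel L r c → colSucc A (cell (r , c)) ≡ cell (suc r , c)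
  colSucc-inner {L} {r} {c} sL<k on =
    cong (_, c mod n) (trans (cong (fromMaybe (r mod n)) (search-first-hit n 1 (colSearch r c) 0 (λ _ ()) hit (s≤s z≤n))) (mod-cong e))
    where
    x = toℕ (r mod n)
    hit : colSearch r c 1 ≡ just ((x + 1) mod n)
    hit = if-true _ (filled-level sL<k (≋-trans (≡⇒≋ (+-comm 1 (L + c))) (≋-trans (≋-+ʳ 1 on) (≋-+ʳ 1 (≋-sym (toℕ-mod-≋ r))))))
    e : x + 1 ≋ suc r
    e = ≋-trans (≋-+ʳ 1 (toℕ-mod-≋ r)) (≡⇒≋ (+-comm r 1))

  colSucc-top : ∀ {r c} → OnLevel k1 r c → colSucc A (cell (r , c)) ≡ cell (r + w , c)
  colSucc-top {r} {c} on =
    cong (_, c mod n) (trans (cong (fromMaybe (r mod n)) (search-first-hit n 1 (colSearch r c) (suc p) miss hit (m<n+m (suc p) {k} (s≤s z≤n)))) (mod-cong (≋-+ʳ w (toℕ-mod-≋ r))))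
    where
    x = toℕ (r mod n)
    c+k1≋x : k1 + c ≋ x
    c+k1≋x = ≋-trans on (≋-sym (toℕ-mod-≋ r))
    miss : ∀ u → u < suc p → colSearch r c (1 + u) ≡ nothing
    miss u u<sp = if-false _ (empty-level (subst (k ≤_) (sym (+-suc k1 u)) (s≤s (m≤m+n k1 u)))
      (subst (k1 + suc u <_) k1+w≡n (+-monoʳ-< k1 (s≤s u<sp)))
      (≋-trans (≡⇒≋ (trans (+-assoc k1 (1 + u) c) (trans (cong (k1 +_) (+-comm (1 + u) c)) (sym (+-assoc k1 c (1 + u))))))
        (≋-+ʳ (1 + u) c+k1≋x)))
    hit : colSearch r c (1 + suc p) ≡ just ((x + w) mod n)
    hit = if-true _ (filled-level (s≤s z≤n) (≋-trans (≋-sym (≋-+n c))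
      (≋-trans (≡⇒≋ (trans (cong (c +_) (sym k1+w≡n)) (trans (sym (+-assoc c k1 w)) (cong (_+ w) (+-comm c k1)))))
        (≋-+ʳ w c+k1≋x))))

  -- above level 0 the column predecessor is the previous row (r - 1 ≡ r + n')
  colPred-upper : ∀ {L r c} → suc L < k → OnLevel (suc L) r c → colPred A (cell (r , c)) ≡ cell (r + n' , c)
  colPred-upper {L} {r} {c} sL<k on =
    cong (_, c mod n) (trans (cong (fromMaybe (r mod n)) (search-first-hit n 1 (colPredSearch r c) 0 (λ _ ()) hit (s≤s z≤n))) (mod-cong (≋-+ʳ n' (toℕ-mod-≋ r))))
    where
    x = toℕ (r mod n)
    hit : colPredSearch r c 1 ≡ just ((x + n') mod n)
    hit = if-true _ (filled-level (<-trans ≤-refl sL<k) (≋-trans (≋-sym (≋-+n (L + c)))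
      (≋-trans (≡⇒≋ (+-suc (L + c) n')) (≋-+ʳ n' (≋-trans on (≋-sym (toℕ-mod-≋ r)))))))

  colPred-level0 : ∀ {r c} → OnLevel 0 r c → colPred A (cell (r , c)) ≡ cell (r + k1 , c)
  colPred-level0 {r} {c} on =
    cong (_, c mod n) (trans (cong (fromMaybe (r mod n)) (search-first-hit n 1 (colPredSearch r c) (suc p) miss hit (m<n+m (suc p) {k} (s≤s z≤n)))) (mod-cong e))
    where
    x = toℕ (r mod n)
    c≋x : c ≋ x
    c≋x = ≋-trans on (≋-sym (toℕ-mod-≋ r))
    miss : ∀ u → u < suc p → colPredSearch r c (1 + u) ≡ nothing
    miss u u<sp = if-false _ (empty-level (band-level u u<sp) (band-level<n u)
      (≋-trans (≋-+ˡ (n ∸ suc u) c≋x) (≡⇒≋ (+-comm (n ∸ suc u) x))))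
    hit : colPredSearch r c (1 + suc p) ≡ just ((x + (n ∸ w)) mod n)
    hit = if-true _ (filled-level (subst (_< k) (sym n∸w≡k1) ≤-refl) (≋-trans (≋-+ˡ (n ∸ w) c≋x) (≡⇒≋ (+-comm (n ∸ w) x))))
    e : x + (n ∸ w) ≋ r + k1
    e = ≋-trans (≋-+ʳ (n ∸ w) (toℕ-mod-≋ r)) (≡⇒≋ (cong (r +_) n∸w≡k1))

  jumps-split : ∀ a m → a + m * k1 + m * w ≡ a + m * n
  jumps-split a m = trans (regroup a m k1 w) (cong (λ z → a + m * z) k1+w≡n)
    where
    regroup : ∀ a m x y → a + m * x + m * y ≡ a + m * (x + y)
    regroup = solve-∀

  back⇒forward : ∀ {x y} m → x + m * k1 ≋ y → x ≋ y + m * w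
  back⇒forward {x} m e = ≋-trans (≋-sym (≋-+*n x m)) (≋-trans (≡⇒≋ (sym (jumps-split x m))) (≋-+ʳ (m * w) e))

  forward⇒back : ∀ {x y} m → x ≋ y + m * w → x + m * k1 ≋ y
  forward⇒back {x} {y} m e = ≋-trans (≋-+ʳ (m * k1) e)
    (≋-trans (≡⇒≋ (trans (+-assoc y (m * w) (m * k1)) (trans (cong (y +_) (+-comm (m * w) (m * k1))) (sym (+-assoc y (m * k1) (m * w))))))
      (≋-trans (≡⇒≋ (jumps-split y m)) (≋-+*n y m)))

-- The reduced dynamics.
module Dynamics (h p : ℕ) (C : Fin (Geometry.n h p) → Sign) where
  open Geometry h p public

  isMinusCol : ℕ → Bool
  isMinusCol x = isMinus (C (x mod n))

  isMinusCol-cong : ∀ {x y} → x ≋ y → isMinusCol x ≡ isMinusCol y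
  isMinusCol-cong e = cong (isMinus ∘ C) (mod-cong e)

  plusCol : ∀ x → C (x mod n) ≡ plus → isMinusCol (x % n) ≡ false
  plusCol x ec = trans (isMinusCol-cong (≋-% x)) (cong isMinus ec)

  minusCol : ∀ x → C (x mod n) ≡ minus → isMinusCol (x % n) ≡ true
  minusCol x ec = trans (isMinusCol-cong (≋-% x)) (cong isMinus ec)

  lower : ℕ → ℕ
  lower zero    = k1
  lower (suc b) = b

  landing : ℕ → ℕ → ℕ → ℕ × ℕ
  landing j' down same = j' , (if isMinusCol j' then down else same)

  landing-minus : ∀ j' down same → isMinusCol j' ≡ true → landing j' down same ≡ (j' , down)
  landing-minus _ _ _ e rewrite e = refl

  landing-plus : ∀ j' down same → isMinusCol j' ≡ false → landing j' down same ≡ (j' , same)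
  landing-plus _ _ _ e rewrite e = refl

  step : ℕ × ℕ → ℕ × ℕ
  step (j , zero)  = landing ((j + w) % n) k2 zero
  step (j , suc b) = landing (suc j % n) (lower b) (suc b)

  Valid : ℕ × ℕ → Set
  Valid (j , a) = j < n × a < k

  encode : ℕ × ℕ → Cell n
  encode (j , a) = cell (j + a , j)

  S : Cell n → Cell n
  S = move A (allPlus n) C

  move-cell : ∀ r c r' c' → rowSucc A (cell (r , c)) ≡ cell (r' , c') →
    S (cell (r , c)) ≡ colStep A (C (c' mod n)) (cell (r' , c'))
  move-cell r c r' c' eq = trans (move-unfold A (allPlus n) C (r mod n) (c mod n)) (cong (λ x → colStep A (C (proj₂ x)) x) eq)

  on-level-shift : ∀ b j → OnLevel b (j + suc b) (suc j)
  on-level-shift b j = ≡⇒≋ (trans (+-suc b j) (trans (cong suc (+-comm b j)) (sym (+-suc j b))))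

  on-top-after-jump : ∀ j → OnLevel k1 (j + 0) (j + w)
  on-top-after-jump j = ≋-trans (≡⇒≋ (trans (sym (+-assoc k1 j w))
    (trans (cong (_+ w) (+-comm k1 j)) (trans (+-assoc j k1 w) (cong (j +_) k1+w≡n)))))
    (≋-trans (≋-+n j) (≡⇒≋ (sym (+-identityʳ j))))

  move-upper : ∀ j b → suc b < k → S (encode (j , suc b)) ≡ encode (step (j , suc b))
  move-upper j b sb<k with C (suc j mod n) in ec
  ... | plus = begin
    S (cell (j + suc b , j))                                 ≡⟨ move-cell (j + suc b) j (j + suc b) (suc j) (rowSucc-upper sb<k (≡⇒≋ (+-comm (suc b) j))) ⟩
    colStep A (C (suc j mod n)) (cell (j + suc b , suc j))   ≡⟨ cong (λ s → colStep A s _) ec ⟩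
    colSucc A (cell (j + suc b , suc j))                     ≡⟨ colSucc-inner sb<k (on-level-shift b j) ⟩
    cell (suc j + suc b , suc j)                             ≡⟨ cell-cong (≋-+ʳ (suc b) (≋-sym (≋-% (suc j)))) (≋-sym (≋-% (suc j))) ⟩
    encode (suc j % n , suc b)                               ≡⟨ cong encode (landing-plus (suc j % n) (lower b) (suc b) (plusCol (suc j) ec)) ⟨
    encode (step (j , suc b))                                ∎
    where open ≡-Reasoning
  ... | minus = begin
    S (cell (j + suc b , j))                                 ≡⟨ move-cell (j + suc b) j (j + suc b) (suc j) (rowSucc-upper sb<k (≡⇒≋ (+-comm (suc b) j))) ⟩
    colStep A (C (suc j mod n)) (cell (j + suc b , suc j))   ≡⟨ cong (λ s → colStep A s _) ec ⟩
    colPred A (cell (j + suc b , suc j))                     ≡⟨ climb b sb<k ⟩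
    encode (suc j % n , lower b)                             ≡⟨ cong encode (landing-minus (suc j % n) (lower b) (suc b) (minusCol (suc j) ec)) ⟨
    encode (step (j , suc b))                                ∎
    where
    open ≡-Reasoning
    climb : ∀ b → suc b < k → colPred A (cell (j + suc b , suc j)) ≡ encode (suc j % n , lower b)
    climb zero _ = trans (colPred-level0 (≡⇒≋ (+-comm 1 j)))
      (cell-cong (≋-+ʳ k1 (≋-trans (≡⇒≋ (+-comm j 1)) (≋-sym (≋-% (suc j))))) (≋-sym (≋-% (suc j))))
    climb (suc b) sb<k = trans (colPred-upper (<-trans (n<1+n (suc b)) sb<k) (on-level-shift (suc b) j))
      (cell-cong (≋-trans (≡⇒≋ (regroup j b n')) (≋-trans (≋-+n (suc j + b)) (≋-+ʳ b (≋-sym (≋-% (suc j))))))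
                 (≋-sym (≋-% (suc j))))
      where
      regroup : ∀ j b n' → j + suc (suc b) + n' ≡ (suc j + b) + suc n'
      regroup = solve-∀

  move-level0 : ∀ j → S (encode (j , 0)) ≡ encode (step (j , 0))
  move-level0 j with C ((j + w) mod n) in ec
  ... | plus = begin
    S (cell (j + 0 , j))                                     ≡⟨ move-cell (j + 0) j (j + 0) (j + w) (rowSucc-level0 (≡⇒≋ (sym (+-identityʳ j)))) ⟩
    colStep A (C ((j + w) mod n)) (cell (j + 0 , j + w))     ≡⟨ cong (λ s → colStep A s _) ec ⟩
    colSucc A (cell (j + 0 , j + w))                         ≡⟨ colSucc-top (on-top-after-jump j) ⟩
    cell (j + 0 + w , j + w)                                 ≡⟨ cell-cong (≋-trans (≡⇒≋ (trans (cong (_+ w) (+-identityʳ j)) (sym (+-identityʳ _)))) (≋-+ʳ 0 (≋-sym (≋-% (j + w))))) (≋-sym (≋-% (j + w))) ⟩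
    encode ((j + w) % n , 0)                                 ≡⟨ cong encode (landing-plus ((j + w) % n) k2 0 (plusCol (j + w) ec)) ⟨
    encode (step (j , 0))                                    ∎
    where open ≡-Reasoning
  ... | minus = begin
    S (cell (j + 0 , j))                                     ≡⟨ move-cell (j + 0) j (j + 0) (j + w) (rowSucc-level0 (≡⇒≋ (sym (+-identityʳ j)))) ⟩
    colStep A (C ((j + w) mod n)) (cell (j + 0 , j + w))     ≡⟨ cong (λ s → colStep A s _) ec ⟩
    colPred A (cell (j + 0 , j + w))                         ≡⟨ colPred-upper ≤-refl (on-top-after-jump j) ⟩
    cell (j + 0 + n' , j + w)                                ≡⟨ cell-cong (≋-trans (≡⇒≋ (regroup j p h)) (≋-+ʳ k2 (≋-sym (≋-% (j + w))))) (≋-sym (≋-% (j + w))) ⟩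
    encode ((j + w) % n , k2)                                ≡⟨ cong encode (landing-minus ((j + w) % n) k2 0 (minusCol (j + w) ec)) ⟨
    encode (step (j , 0))                                    ∎
    where
    open ≡-Reasoning
    regroup : ∀ j p h → j + 0 + (suc (suc (h + h)) + suc p) ≡ j + suc (suc p) + suc (h + h)
    regroup = solve-∀

  step-valid : ∀ {s} → Valid s → Valid (step s)
  step-valid {j , zero} _ with isMinusCol ((j + w) % n)
  ... | true  = %<n (j + w) , <-trans ≤-refl ≤-refl
  ... | false = %<n (j + w) , s≤s z≤n
  step-valid {j , suc b} (_ , sb<k) with isMinusCol (suc j % n)
  ... | true  = %<n (suc j) , lower< b sb<k
    where
    lower< : ∀ b → suc b < k → lower b < k
    lower< zero    _    = ≤-refl
    lower< (suc b) sb<k = <-trans (<-trans (n<1+n b) (n<1+n (suc b))) sb<k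
  ... | false = %<n (suc j) , sb<k

  lower-injective : ∀ b b' → suc b < k → suc b' < k → lower b ≡ lower b' → b ≡ b'
  lower-injective zero    zero     _                _                _ = refl
  lower-injective zero    (suc c') _                (s≤s (s≤s c'<)) e = ⊥-elim (<-irrefl (sym e) (≤-trans c'< (n≤1+n _)))
  lower-injective (suc c) zero     (s≤s (s≤s c<))  _                e = ⊥-elim (<-irrefl e (≤-trans c< (n≤1+n _)))
  lower-injective (suc c) (suc c') _                _                e = cong suc e

  level0≢upper : ∀ j j' b → suc b < k → step (j , 0) ≢ step (j' , suc b)
  level0≢upper j j' b sb<k eq with cong proj₁ eq
  ... | same-col with isMinusCol ((j + w) % n) in e1 | isMinusCol (suc j' % n) in e2
  ... | true  | true  = k2≢lower b sb<k (cong proj₂ eq)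
    where
    k2≢lower : ∀ b → suc b < k → k2 ≢ lower b
    k2≢lower zero    _              e = <-irrefl e ≤-refl
    k2≢lower (suc c) (s≤s (s≤s c<)) e = <-irrefl (sym e) c<
  ... | true  | false = true≢false (trans (sym e1) (trans (cong isMinusCol same-col) e2))
  ... | false | true  = true≢false (trans (sym e2) (trans (cong isMinusCol (sym same-col)) e1))
  ... | false | false with () ← cong proj₂ eq

  step-injective : ∀ {s s'} → Valid s → Valid s' → step s ≡ step s' → s ≡ s'
  step-injective {j , zero} {j' , zero} (j<n , _) (j'<n , _) eq =
    cong (_, 0) (≋⇒≡ j<n j'<n (≋-cancelʳ w (mk≋ (cong proj₁ eq))))
  step-injective {j , suc b} {j' , suc b'} (j<n , sb<k) (j'<n , sb'<k) eq
    with ≋⇒≡ j<n j'<n (≋-cancelˡ 1 (mk≋ (cong proj₁ eq)))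
  ... | refl with isMinusCol (suc j % n)
  ... | true  = cong (j ,_) (cong suc (lower-injective b b' sb<k sb'<k (cong proj₂ eq)))
  ... | false = cong (j ,_) (cong proj₂ eq)
  step-injective {j , zero}  {j' , suc b} _        (_ , sb<k) eq = ⊥-elim (level0≢upper j j' b sb<k eq)
  step-injective {j , suc b} {j' , zero}  (_ , sb<k) _      eq = ⊥-elim (level0≢upper j' j b sb<k (sym eq))

  code : ℕ × ℕ → ℕ
  code (j , a) = j + a * n

  code< : ∀ {s} → Valid s → code s < k * n
  code< {j , a} (j<n , a<k) = <-≤-trans (+-monoˡ-< (a * n) j<n) (*-monoˡ-≤ n a<k)

  code-injective : ∀ {s s'} → Valid s → Valid s' → code s ≡ code s' → s ≡ s'
  code-injective {j , a} {j' , a'} (j<n , _) (j'<n , _) e =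
    cong₂ _,_ j≡j' (*-cancelʳ-≡ a a' n (+-cancelˡ-≡ j _ _ (trans e (cong (_+ a' * n) (sym j≡j')))))
    where
    j≡j' : j ≡ j'
    j≡j' = ≋⇒≡ j<n j'<n (≋-trans (≋-sym (≋-+*n j a)) (≋-trans (≡⇒≋ e) (≋-+*n j' a')))

  open FinitePermutation step Valid step-valid step-injective (k * n) code code< code-injective public

  move-step : ∀ {s} → Valid s → S (encode s) ≡ encode (step s)
  move-step {j , zero}  _          = move-level0 j
  move-step {j , suc b} (_ , sb<k) = move-upper j b sb<k

  iter-move-step : ∀ m {s} → Valid s → iter S m (encode s) ≡ encode (iter step m s)
  iter-move-step zero    v = refl
  iter-move-step (suc m) v = trans (cong S (iter-move-step m v)) (move-step (iter-valid m v))

  encode-injective : ∀ {s s'} → Valid s → Valid s' → encode s ≡ encode s' → s ≡ s'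
  encode-injective {j , a} {j' , a'} (j<n , a<k) (j'<n , a'<k) e =
    cong₂ _,_ j≡j' (≋⇒≡ (<-trans a<k k<n) (<-trans a'<k k<n) (≋-cancelˡ j rows))
    where
    j≡j' : j ≡ j'
    j≡j' = ≋⇒≡ j<n j'<n (mk≋ (trans (sym (toℕ-mod j)) (trans (cong (toℕ ∘ proj₂) e) (toℕ-mod j'))))
    rows : j + a ≋ j + a'
    rows = mk≋ (trans (sym (toℕ-mod (j + a))) (trans (cong (toℕ ∘ proj₁) e)
             (trans (toℕ-mod (j' + a')) (cong (λ z → (z + a') % n) (sym j≡j')))))

  encode-filled : ∀ {s} → Valid s → Filled A (encode s)
  encode-filled {j , a} (_ , a<k) = subst T (sym (filled-level a<k (≡⇒≋ (+-comm a j)))) tt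

  decode : ∀ x → Filled A x → ∃ λ s → Valid s × encode s ≡ x
  decode (i , j) filled with any-applyUpTo⁻ (λ a → ((a + toℕ j) % n) ≡ᵇ toℕ i) (λ x → x) k (T⇒≡true filled)
  ... | a , a<k , fa = (toℕ j , a) , (toℕ<n j , a<k) , cong₂ _,_
        (toℕ-injective (trans (toℕ-mod (toℕ j + a)) (trans (cong (_% n) (+-comm (toℕ j) a)) (≡ᵇ-sound _ _ fa))))
        (mod-toℕ j)

  Connected : Set
  Connected = ∀ s s' → Valid s → Valid s' → Reaches step s s'

  solution⇒connected : IsSolution A (allPlus n) C → Connected
  solution⇒connected sol s s' v v' with sol (encode s) (encode s') (encode-filled v) (encode-filled v')
  ... | m , e = m , encode-injective (iter-valid m v) v' (trans (sym (iter-move-step m v)) e)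

  connected⇒solution : Connected → IsSolution A (allPlus n) C
  connected⇒solution conn x y fx fy with decode x fx | decode y fy
  ... | s , v , refl | s' , v' , refl with conn s s' v v'
  ... | m , e = m , trans (iter-move-step m v) (cong encode e)

  -- The minus columns.  E lists them increasingly (1-based); col i is the
  -- 0-based column of the i-th one.  Afterwards only the properties below
  -- are used, so col is kept opaque.

  E : List ℕ
  E = minusPositions C

  t : ℕ
  t = length E

  E-entry : ∀ i → ∃ λ (x : Fin n) → lookup E i ≡ suc (toℕ x) × isMinus (C x) ≡ true
  E-entry i with ∈-map⁻ (λ j → suc (toℕ j)) (∈-lookup {xs = E} i)
  ... | x , mem , eq = x , eq , T⇒≡true (proj₂ (∈-filter⁻ (T? ∘ (isMinus ∘ C)) mem))

  -- E is strictly increasing, as a filter of 1, …, n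
  E-increasing : AllPairs _<_ E
  E-increasing = AllPairs.map⁺ (AllPairs.filter⁺ (T? ∘ (isMinus ∘ C)) (AllPairs.tabulate⁺-< {f = λ x → x} s≤s))

  opaque
    col : Fin t → ℕ
    col i = pred (lookup E i)

    lookup-col : ∀ i → lookup E i ≡ suc (col i)
    lookup-col i with E-entry i
    ... | x , eq , _ = trans eq (cong suc (cong pred (sym eq)))

    col<n : ∀ i → col i < n
    col<n i with E-entry i
    ... | x , eq , _ = subst (_< n) (cong pred (sym eq)) (toℕ<n x)

    col-minus : ∀ i → isMinusCol (col i) ≡ true
    col-minus i with E-entry i
    ... | x , eq , mx = trans (cong (λ z → isMinus (C z)) (trans (cong (_mod n) (cong pred eq)) (mod-toℕ x))) mx

    minus⇒col : ∀ c → c < n → isMinusCol c ≡ true → ∃ λ i → col i ≡ c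
    minus⇒col c c<n mc = index mem , trans (cong pred (sym (lookup-index mem))) (trans (toℕ-mod c) (m<n⇒m%n≡m c<n))
      where
      mem : suc (toℕ (c mod n)) ∈ E
      mem = ∈-map⁺ (λ j → suc (toℕ j)) (∈-filter⁺ (T? ∘ (isMinus ∘ C)) (∈-allFin (c mod n)) (≡true⇒T mc))

    col-monotone : ∀ i j → toℕ i < toℕ j → col i < col j
    col-monotone i j i<j = subst₂ _<_ (cong pred (lookup-col i)) (cong pred (lookup-col j))
      (≤-pred (subst₂ _<_ (lookup-col i) (lookup-col j) (AllPairs-lookup E-increasing i j i<j)))

  col-reflects-< : ∀ i j → col i < col j → toℕ i < toℕ j
  col-reflects-< i j ci<cj with <-cmp (toℕ i) (toℕ j)
  ... | tri< lt _ _ = lt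
  ... | tri≈ _ e _  = ⊥-elim (<-irrefl (cong col (toℕ-injective e)) ci<cj)
  ... | tri> _ _ gt = ⊥-elim (<-asym ci<cj (col-monotone j i gt))

  col-injective : ∀ i j → col i ≡ col j → i ≡ j
  col-injective i j e with <-cmp (toℕ i) (toℕ j)
  ... | tri< lt _ _ = ⊥-elim (<-irrefl e (col-monotone i j lt))
  ... | tri≈ _ e' _ = toℕ-injective e'
  ... | tri> _ _ gt = ⊥-elim (<-irrefl (sym e) (col-monotone j i gt))

  -- Paths between hubs.  The hub states are the level-0 states in minus
  -- columns.  A Path from x to y reaches y in r ≥ 1 steps and meets no hub
  -- state strictly in between; so the hub after (col i , 0) is identified.

  NotHub : ℕ × ℕ → Set
  NotHub (j , zero)  = isMinusCol j ≡ false
  NotHub (j , suc _) = ⊤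

  Path : ℕ × ℕ → ℕ × ℕ → Set
  Path x y = Σ ℕ λ r → 1 ≤ r × iter step r x ≡ y × (∀ s → 0 < s → s < r → NotHub (iter step s x))

  path-++ : ∀ {x y z} → Path x y → NotHub y → Path y z → Path x z
  path-++ {x} {y} {z} (r₁ , 1≤r₁ , e₁ , off₁) y-off (r₂ , _ , e₂ , off₂) =
    r₂ + r₁ , ≤-trans 1≤r₁ (m≤n+m r₁ r₂) , trans (iter-+ step r₂ r₁ x) (trans (cong (iter step r₂) e₁) e₂) , off
    where
    off : ∀ s → 0 < s → s < r₂ + r₁ → NotHub (iter step s x)
    off s 0<s s<r with <-cmp s r₁
    ... | tri< s<r₁ _ _ = off₁ s 0<s s<r₁
    ... | tri≈ _ s≡r₁ _ = subst NotHub (sym (trans (cong (λ u → iter step u x) s≡r₁) e₁)) y-off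
    ... | tri> _ _ s>r₁ = subst NotHub (sym later)
          (off₂ (s ∸ r₁) (m<n⇒0<n∸m s>r₁) (+-cancelʳ-< r₁ (s ∸ r₁) r₂ (subst (_< r₂ + r₁) (sym (m∸n+n≡m (<⇒≤ s>r₁))) s<r)))
      where
      later : iter step s x ≡ iter step (s ∸ r₁) y
      later = trans (cong (λ u → iter step u x) (sym (m∸n+n≡m (<⇒≤ s>r₁))))
                    (trans (iter-+ step (s ∸ r₁) r₁ x) (cong (iter step (s ∸ r₁)) e₁))

  walk-plus : ∀ s j b → j < n → (∀ v → 1 ≤ v → v ≤ s → isMinusCol ((j + v) % n) ≡ false) →
    iter step s (j , suc b) ≡ ((j + s) % n , suc b)
  walk-plus zero    j b j<n _    = cong (_, suc b) (sym (trans (cong (_% n) (+-identityʳ j)) (m<n⇒m%n≡m j<n)))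
  walk-plus (suc s) j b j<n clear = trans (cong step (walk-plus s j b j<n (λ v 1≤v v≤s → clear v 1≤v (m≤n⇒m≤1+n v≤s))))
      (trans (landing-plus (suc ((j + s) % n) % n) (lower b) (suc b) lands-plus) (cong (_, suc b) (un≋ e)))
    where
    e : suc ((j + s) % n) ≋ j + suc s
    e = ≋-trans (≋-+ˡ 1 (≋-% (j + s))) (≡⇒≋ (sym (+-suc j s)))
    lands-plus : isMinusCol (suc ((j + s) % n) % n) ≡ false
    lands-plus = trans (isMinusCol-cong (≋-trans (≋-% (suc ((j + s) % n))) (≋-trans e (≋-sym (≋-% (j + suc s))))))
                  (clear (suc s) (s≤s z≤n) ≤-refl)

  jump-plus : ∀ s j → j < n → (∀ v → 1 ≤ v → v ≤ s → isMinusCol ((j + v * w) % n) ≡ false) →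
    iter step s (j , 0) ≡ ((j + s * w) % n , 0)
  jump-plus zero    j j<n _    = cong (_, 0) (sym (trans (cong (_% n) (+-identityʳ j)) (m<n⇒m%n≡m j<n)))
  jump-plus (suc s) j j<n clear = trans (cong step (jump-plus s j j<n (λ v 1≤v v≤s → clear v 1≤v (m≤n⇒m≤1+n v≤s))))
      (trans (landing-plus (((j + s * w) % n + w) % n) k2 0 lands-plus) (cong (_, 0) (un≋ e)))
    where
    e : (j + s * w) % n + w ≋ j + suc s * w
    e = ≋-trans (≋-+ʳ w (≋-% (j + s * w))) (≡⇒≋ (regroup j s w))
      where
      regroup : ∀ j s w → j + s * w + w ≡ j + (w + s * w)
      regroup = solve-∀
    lands-plus : isMinusCol (((j + s * w) % n + w) % n) ≡ false
    lands-plus = trans (isMinusCol-cong (≋-trans (≋-% ((j + s * w) % n + w)) (≋-trans e (≋-sym (≋-% (j + suc s * w))))))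
                  (clear (suc s) (s≤s z≤n) ≤-refl)

  segment : ∀ j j' D b → j < n → 1 ≤ D → j + D ≋ j' → j' < n → isMinusCol j' ≡ true →
    (∀ v → 1 ≤ v → v < D → isMinusCol ((j + v) % n) ≡ false) → Path (j , suc b) (j' , lower b)
  segment j j' (suc d) b j<n _ jD j'<n lands-minus clear =
    suc d , s≤s z≤n ,
    trans (cong step (walk-plus d j b j<n (λ v 1≤v v≤d → clear v 1≤v (s≤s v≤d))))
      (trans (landing-minus (suc ((j + d) % n) % n) (lower b) (suc b) (trans (isMinusCol-cong (≋-trans (≋-% (suc ((j + d) % n))) e)) lands-minus))
             (cong (_, lower b) (trans (un≋ e) (m<n⇒m%n≡m j'<n)))) ,
    λ s _ s<sd → subst NotHub (sym (walk-plus s j b j<n (λ v 1≤v v≤s → clear v 1≤v (≤-trans (s≤s v≤s) s<sd)))) tt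
    where
    e : suc ((j + d) % n) ≋ j'
    e = ≋-trans (≋-+ˡ 1 (≋-% (j + d))) (≋-trans (≡⇒≋ (sym (+-suc j d))) jD)

  next : Fin t → Fin t
  next = shiftIdx t 1

  Gap : Fin t → ℕ → Set
  Gap i D = 1 ≤ D × col i + D ≋ col (next i) × (∀ v → 1 ≤ v → v < D → isMinusCol ((col i + v) % n) ≡ false)

  gap-inner : ∀ i → suc (toℕ i) < t → ∃ (Gap i)
  gap-inner i lt = D , m<n⇒0<n∸m ci<ci' , ≡⇒≋ (m+[n∸m]≡n (<⇒≤ ci<ci')) , clear
    where
    i' = next i
    i<i' : toℕ i < toℕ i'
    i<i' = subst (toℕ i <_) (sym (shiftIdx-1-inner t i lt)) ≤-refl
    ci<ci' : col i < col i'
    ci<ci' = col-monotone i i' i<i'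
    D = col i' ∸ col i
    clear : ∀ v → 1 ≤ v → v < D → isMinusCol ((col i + v) % n) ≡ false
    clear v 1≤v v<D with isMinusCol ((col i + v) % n) in e
    ... | false = refl
    ... | true with minus⇒col _ (%<n (col i + v)) e
    ... | i'' , ci'' = ⊥-elim (<⇒≱ (col-reflects-< i'' i' (subst (_< col i') (sym ci''≡) before))
                                   (subst (_≤ toℕ i'') (sym (shiftIdx-1-inner t i lt))
                                     (col-reflects-< i i'' (subst (col i <_) (sym ci''≡) (m<m+n (col i) 1≤v)))))
      where
      before : col i + v < col i'
      before = subst (col i + v <_) (m+[n∸m]≡n (<⇒≤ ci<ci')) (+-monoʳ-< (col i) v<D)
      ci''≡ : col i'' ≡ col i + v
      ci''≡ = trans ci'' (m<n⇒m%n≡m (<-trans before (col<n i')))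

  gap-last : ∀ i → suc (toℕ i) ≡ t → ∃ (Gap i)
  gap-last i last = D , m<n⇒0<n∸m ci<c0+n , ≋-trans (≡⇒≋ (m+[n∸m]≡n (<⇒≤ ci<c0+n))) (≋-+n (col i0)) , clear
    where
    i0 = next i
    i0≡0 : toℕ i0 ≡ 0
    i0≡0 = shiftIdx-1-last t i last
    ci<c0+n : col i < col i0 + n
    ci<c0+n = <-≤-trans (col<n i) (m≤n+m n (col i0))
    D = (col i0 + n) ∸ col i
    clear : ∀ v → 1 ≤ v → v < D → isMinusCol ((col i + v) % n) ≡ false
    clear v 1≤v v<D with isMinusCol ((col i + v) % n) in e
    ... | false = refl
    ... | true with minus⇒col _ (%<n (col i + v)) e
    ...   | i'' , ci'' with col i + v <? n
    ...     | yes small = ⊥-elim (<⇒≱ (toℕ<n i'') (subst (_≤ toℕ i'') last (col-reflects-< i i''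
                (subst (col i <_) (sym (trans ci'' (m<n⇒m%n≡m small))) (m<m+n (col i) 1≤v)))))
    ...     | no big = ⊥-elim (<⇒≱ (col-reflects-< i'' i0 (subst (_< col i0) (sym (trans ci'' wrapped)) below))
                                   (subst (_≤ toℕ i'') (sym i0≡0) z≤n))
      where
      before : col i + v < col i0 + n
      before = subst (col i + v <_) (m+[n∸m]≡n (<⇒≤ ci<c0+n)) (+-monoʳ-< (col i) v<D)
      wrapped : (col i + v) % n ≡ col i + v ∸ n
      wrapped = trans (sym (m≤n⇒[n∸m]%m≡n%m (≮⇒≥ big)))
        (m<n⇒m%n≡m (subst (col i + v ∸ n <_) (m+n∸n≡m n n) (∸-monoˡ-< (<-trans before (+-monoˡ-< n (col<n i0))) (≮⇒≥ big))))
      below : col i + v ∸ n < col i0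
      below = subst (col i + v ∸ n <_) (m+n∸n≡m (col i0) n) (∸-monoˡ-< before (≮⇒≥ big))

  gap : ∀ i → ∃ (Gap i)
  gap i with m≤n⇒m<n∨m≡n (toℕ<n i)
  ... | inj₁ lt   = gap-inner i lt
  ... | inj₂ last = gap-last i last

  segment-next : ∀ i b → Path (col i , suc b) (col (next i) , lower b)
  segment-next i b with gap i
  ... | D , 1≤D , arrive , clear = segment (col i) (col (next i)) D b (col<n i) 1≤D arrive (col<n (next i)) (col-minus (next i)) clear

  module Jump (i : Fin t) where

    Hit : ℕ → ℕ → Bool
    Hit m e'' = ((e'' + m * k1) % n) ≡ᵇ (lookup E i % n)

    Found : ℕ → Maybe (Fin t)
    Found m = findIndexᵇ (Hit m) E

    hit⇒col : ∀ m x → Hit m (lookup E x) ≡ true → col x ≡ (col i + m * w) % n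
    hit⇒col m x e = trans (sym (m<n⇒m%n≡m (col<n x))) (un≋ (≋-cancelˡ 1 (back⇒forward m back)))
      where
      back : suc (col x) + m * k1 ≋ suc (col i)
      back = mk≋ (subst₂ (λ u v → (u + m * k1) % n ≡ v % n) (lookup-col x) (lookup-col i) (≡ᵇ-sound _ _ e))

    col⇒hit : ∀ m x → col x ≡ (col i + m * w) % n → Hit m (lookup E x) ≡ true
    col⇒hit m x e = subst₂ (λ u v → ((u + m * k1) % n ≡ᵇ v % n) ≡ true) (sym (lookup-col x)) (sym (lookup-col i))
      (subst (λ z → ((suc (col x) + m * k1) % n ≡ᵇ z) ≡ true) (un≋ back) (≡ᵇ-refl ((suc (col x) + m * k1) % n)))
      where
      back : suc (col x) + m * k1 ≋ suc (col i)
      back = forward⇒back m (≋-+ˡ 1 (≋-trans (≡⇒≋ e) (≋-% (col i + m * w))))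

    miss⇒plus : ∀ m → Found m ≡ nothing → isMinusCol ((col i + m * w) % n) ≡ false
    miss⇒plus m none with isMinusCol ((col i + m * w) % n) in e
    ... | false = refl
    ... | true with minus⇒col _ (%<n (col i + m * w)) e
    ... | x , cx = ⊥-elim (true≢false (trans (sym (col⇒hit m x cx)) (findIndexᵇ-nothing (Hit m) E none x)))

    jump-found : ∀ b → search n 1 Found ≡ just b → Path (col i , 0) (col b , k2)
    jump-found b found with search-success n 1 Found found
    ... | u , _ , hit , before = suc u , s≤s z≤n , arrive , off
      where
      clear : ∀ v → 1 ≤ v → v ≤ u → isMinusCol ((col i + v * w) % n) ≡ false
      clear (suc v) _ v≤u = miss⇒plus (suc v) (before v v≤u)
      lands : ((col i + u * w) % n + w) % n ≡ col b
      lands = trans (un≋ (≋-trans (≋-+ʳ w (≋-% (col i + u * w))) (≡⇒≋ (regroup (col i) u w))))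
                    (sym (hit⇒col (suc u) b (findIndexᵇ-just (Hit (suc u)) E hit)))
        where
        regroup : ∀ j s w → j + s * w + w ≡ j + (w + s * w)
        regroup = solve-∀
      arrive : iter step (suc u) (col i , 0) ≡ (col b , k2)
      arrive = trans (cong step (jump-plus u (col i) (col<n i) clear))
                 (trans (landing-minus _ k2 0 (trans (cong isMinusCol lands) (col-minus b))) (cong (_, k2) lands))
      off : ∀ s → 0 < s → s < suc u → NotHub (iter step s (col i , 0))
      off s 0<s (s≤s s≤u) = subst NotHub (sym (jump-plus s (col i) (col<n i) (λ v 1≤v v≤s → clear v 1≤v (≤-trans v≤s s≤u))))
                                  (clear s 0<s s≤u)

  -- the search of ω₁ always succeeds: after n jumps one is back at col i
  jump-to-ω₁ : ∀ i → Path (col i , 0) (col (ω₁ n k E i) , k2)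
  jump-to-ω₁ i with search n 1 (Jump.Found i) in found
  ... | just b  = Jump.jump-found i b found
  ... | nothing = ⊥-elim (true≢false (trans (sym (Jump.col⇒hit i n i back-home))
                    (findIndexᵇ-nothing (Jump.Hit i n) E (search-failure n 1 (Jump.Found i) found n' ≤-refl) i)))
    where
    back-home : col i ≡ (col i + n * w) % n
    back-home = trans (sym (m<n⇒m%n≡m (col<n i)))
      (sym (un≋ (≋-trans (≡⇒≋ (cong (col i +_) (*-comm n w))) (≋-+*n (col i) w))))

  -- 2u, computed so that double (suc u) ≡ suc (suc (double u)) holds by definition
  double : ℕ → ℕ
  double zero    = zero
  double (suc u) = suc (suc (double u))

  double≡u+u : ∀ u → double u ≡ u + u
  double≡u+u zero    = refl
  double≡u+u (suc u) = cong suc (trans (cong suc (double≡u+u u)) (sym (+-suc u u)))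

  descend-even : ∀ u i → Path (col i , suc (suc (double u))) (col (shiftIdx t (suc u) i) , 0)
  descend-even zero    i = segment-next i 1
  descend-even (suc u) i = subst (λ z → Path (col i , suc (suc (double (suc u)))) (col z , 0)) (shiftIdx-+ t (suc u) 1 i)
    (path-++ (segment-next i (suc (suc (suc (double u))))) tt (descend-even u (next i)))

  -- from level 2u+1, u segments lead to level 1, one more to level k-1 = 2h+2,
  -- and h+1 more down to level 0
  descend-odd : ∀ u i → Path (col i , suc (double u)) (col (shiftIdx t (u + suc (suc h)) i) , 0)
  descend-odd zero    i = subst (λ z → Path (col i , 1) (col z , 0)) (shiftIdx-+ t (suc h) 1 i)
    (path-++ (segment-next i 0) tt
      (subst (λ z → Path (col (next i) , z) (col (shiftIdx t (suc h) (next i)) , 0)) (cong (λ z → suc (suc z)) (double≡u+u h))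
        (descend-even h (next i))))
  descend-odd (suc u) i = subst (λ z → Path (col i , suc (double (suc u))) (col z , 0)) (shiftIdx-+ t (u + suc (suc h)) 1 i)
    (path-++ (segment-next i (suc (suc (double u)))) tt (descend-odd u (next i)))

  -- The first-return map to the hub states.  Opaque outside hub-step: the
  -- rest of the argument uses g only through hub-step, and unfolding the
  -- searches inside ω₁ during conversion checking is very costly.
  opaque
    g : Fin t → Fin t
    g = ω₂ k E ∘ ω₁ n k E

    g-definition : g ≡ ω₂ k E ∘ ω₁ n k E
    g-definition = refl

    -- from hub (col i , 0) the next hub is (col (g i) , 0): a jump to level
    -- k-2, then k-1 segments down to level 0
    hub-step : ∀ i → Path (col i , 0) (col (g i) , 0)
    hub-step i = path-++ (jump-to-ω₁ i) tt
      (subst₂ (λ a z → Path (col (ω₁ n k E i) , a) (col (shiftIdx t z (ω₁ n k E i)) , 0))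
        (cong suc (double≡u+u h)) (trans (+-suc h (suc h)) (cong suc (+-suc h h)))
        (descend-odd h (ω₁ n k E i)))

  LandsOnMinus : ℕ × ℕ → ℕ → Set
  LandsOnMinus s a = ∃ λ j' → j' < n × isMinusCol j' ≡ true × Reaches step s (j' , a)

  lands-via : ∀ {s s' a} → Reaches step s s' → LandsOnMinus s' a → LandsOnMinus s a
  lands-via r (j' , j'<n , minus' , r') = j' , j'<n , minus' , reaches-trans r r'

  ReachesHub : ℕ × ℕ → Set
  ReachesHub s = ∃ λ i → Reaches step s (col i , 0)

  hub-via : ∀ {s s'} → Reaches step s s' → ReachesHub s' → ReachesHub s
  hub-via r (i , r') = i , reaches-trans r r'

  hub-reached : ∀ {s} → LandsOnMinus s 0 → ReachesHub s
  hub-reached (j' , j'<n , minus' , r) with minus⇒col j' j'<n minus'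
  ... | i , refl = i , r

  walk-to-minus : ∀ s j b → isMinusCol ((j + suc s) % n) ≡ true → LandsOnMinus (j , suc b) (lower b)
  walk-to-minus s j b minus' with isMinusCol (suc j % n) in e
  ... | true  = suc j % n , %<n (suc j) , e , 1 , landing-minus (suc j % n) (lower b) (suc b) e
  walk-to-minus zero    j b minus' | false =
    ⊥-elim (true≢false (trans (sym minus') (trans (cong (λ z → isMinusCol (z % n)) (+-comm j 1)) e)))
  walk-to-minus (suc s) j b minus' | false = lands-via (1 , landing-plus (suc j % n) (lower b) (suc b) e)
    (walk-to-minus s (suc j % n) b (trans (isMinusCol-cong (≋-trans (≋-% (suc j % n + suc s))
      (≋-trans (≋-+ʳ (suc s) (≋-% (suc j))) (≋-trans (≡⇒≋ (sym (+-suc j (suc s)))) (≋-sym (≋-% (j + suc (suc s)))))))) minus'))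

  jump-to-minus : ∀ m j → isMinusCol ((j + suc m * w) % n) ≡ true → LandsOnMinus (j , 0) k2
  jump-to-minus m j minus' with isMinusCol ((j + w) % n) in e
  ... | true  = (j + w) % n , %<n (j + w) , e , 1 , landing-minus ((j + w) % n) k2 0 e
  jump-to-minus zero    j minus' | false =
    ⊥-elim (true≢false (trans (sym minus') (trans (cong (λ z → isMinusCol ((j + z) % n)) (+-identityʳ w)) e)))
  jump-to-minus (suc m) j minus' | false = lands-via (1 , landing-plus ((j + w) % n) k2 0 e)
    (jump-to-minus m ((j + w) % n) (trans (isMinusCol-cong (≋-trans (≋-% ((j + w) % n + suc m * w))
      (≋-trans (≋-+ʳ (suc m * w) (≋-% (j + w))) (≋-trans (≡⇒≋ (+-assoc j w (suc m * w))) (≋-sym (≋-% (j + suc (suc m) * w))))))) minus'))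

  even-or-odd : ∀ b → (∃ λ u → b ≡ double u) ⊎ (∃ λ u → b ≡ suc (double u))
  even-or-odd zero = inj₁ (0 , refl)
  even-or-odd (suc b) with even-or-odd b
  ... | inj₁ (u , e) = inj₂ (u , cong suc e)
  ... | inj₂ (u , e) = inj₁ (suc u , cong suc e)

  module ReachHub (c0 : ℕ) (c0<n : c0 < n) (minus-c0 : isMinusCol c0 ≡ true)
    (jumps-meet : ∀ j → j < n → ∃ λ m → isMinusCol ((j + suc m * w) % n) ≡ true) where

    walk-any : ∀ j b → j < n → LandsOnMinus (j , suc b) (lower b)
    walk-any j b j<n = walk-to-minus ((c0 + n) ∸ suc j) j b (trans (isMinusCol-cong (≋-trans (≋-% _)
      (≋-trans (≡⇒≋ (trans (+-suc j _) (m+[n∸m]≡n (<-≤-trans j<n (m≤n+m n c0))))) (≋-+n c0)))) minus-c0)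

    descend-hub-even : ∀ u j → j < n → ReachesHub (j , suc (suc (double u)))
    descend-hub-even zero    j j<n = hub-reached (walk-any j 1 j<n)
    descend-hub-even (suc u) j j<n with walk-any j (suc (suc (suc (double u)))) j<n
    ... | j' , j'<n , _ , r = hub-via r (descend-hub-even u j' j'<n)

    descend-hub-odd : ∀ u j → j < n → ReachesHub (j , suc (double u))
    descend-hub-odd zero    j j<n with walk-any j 0 j<n
    ... | j' , j'<n , _ , r = hub-via r (subst (λ z → ReachesHub (j' , suc (suc z))) (double≡u+u h) (descend-hub-even h j' j'<n))
    descend-hub-odd (suc u) j j<n with walk-any j (suc (suc (double u))) j<n
    ... | j' , j'<n , _ , r = hub-via r (descend-hub-odd u j' j'<n)

    reach-hub : ∀ {s} → Valid s → ReachesHub s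
    reach-hub {j , zero} (j<n , _) with jumps-meet j j<n
    ... | m , minus' with jump-to-minus m j minus'
    ... | j' , j'<n , _ , r = hub-via r (subst (λ z → ReachesHub (j' , suc z)) (double≡u+u h) (descend-hub-odd h j' j'<n))
    reach-hub {j , suc b} (j<n , _) with even-or-odd b
    ... | inj₁ (u , refl) = descend-hub-odd u j j<n
    ... | inj₂ (u , refl) = descend-hub-even u j j<n

  -- Congruence classes modulo d = gcd(n, k-1).  Jumps (by w ≡ 0 mod d)
  -- preserve the class of a column, and reach every column of that class.

  d : ℕ
  d = gcd n k1

  instance
    d-nonZero : NonZero d
    d-nonZero = ≢-nonZero (gcd[m,n]≢0 n k1 (inj₁ (λ ())))

  d∣n : d ∣ℕ n
  d∣n = gcd[m,n]∣m n k1

  d∣w : d ∣ℕ w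
  d∣w = ∣m+n∣m⇒∣n (subst (d ∣ℕ_) (sym k1+w≡n) d∣n) (gcd[m,n]∣n n k1)

  -- Bézout: X·(k-1) ≡ -d modulo n.  Opaque: only its statement is used, and
  -- unfolding the Bézout computation on symbolic arguments is prohibitive.
  opaque
    bezout : ∃ λ X → ∃ λ Z → X * k1 + d ≡ Z * n
    bezout with Bézout.identity (gcd-GCD n k1)
    ... | Bézout.+- x y eq = y , x , trans (+-comm (y * k1) d) eq
    ... | Bézout.-+ x y eq = y * n' , d + n' * x , (begin
      y * n' * k1 + d           ≡⟨ cong (_+ d) (trans (reorder y n' k1) (cong (n' *_) (sym eq))) ⟩
      n' * (d + x * n) + d      ≡⟨ expand n' d x ⟩
      (d + n' * x) * n          ∎)
      where
      open ≡-Reasoning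
      reorder : ∀ y n' k1 → y * n' * k1 ≡ n' * (y * k1)
      reorder = solve-∀
      expand : ∀ n' d x → n' * (d + x * suc n') + d ≡ (d + n' * x) * suc n'
      expand = solve-∀

  forward-by-d : ∀ j u → ∃ λ m → j + m * w ≋ j + u * d
  forward-by-d j u with bezout
  ... | X , Z , XZ = u * X , ≋-trans (≋-sym (≋-+*n (j + u * X * w) (u * Z))) (≋-trans (≡⇒≋ (begin
    j + u * X * w + u * Z * n        ≡⟨ cong (j + u * X * w +_) (trans (*-assoc u Z n) (cong (u *_) (sym XZ))) ⟩
    j + u * X * w + u * (X * k1 + d) ≡⟨ regroup j u X k1 w d ⟩
    j + u * d + u * X * (k1 + w)     ≡⟨ cong (λ z → j + u * d + u * X * z) k1+w≡n ⟩
    j + u * d + u * X * n            ∎)) (≋-+*n (j + u * d) (u * X)))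
    where
    open ≡-Reasoning
    regroup : ∀ j u X k1 w d → j + u * X * w + u * (X * k1 + d) ≡ j + u * d + u * X * (k1 + w)
    regroup = solve-∀

  backward-by-d : ∀ c u → ∃ λ m → c + u * d + m * w ≋ c
  backward-by-d c u with bezout
  ... | X , Z , XZ = m , ≋-trans (≋-sym (≋-+*n (c + u * d + m * w) (u * n' * Z))) (≋-trans (≡⇒≋ (begin
    c + u * d + m * w + u * n' * Z * n         ≡⟨ cong (c + u * d + m * w +_) (trans (*-assoc (u * n') Z n) (cong (u * n' *_) (sym XZ))) ⟩
    c + u * d + m * w + u * n' * (X * k1 + d)  ≡⟨ regroup c u d n' X k1 w ⟩
    c + u * d * n + m * (k1 + w)               ≡⟨ cong (λ z → c + u * d * n + m * z) k1+w≡n ⟩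
    c + u * d * n + m * n                      ≡⟨ collect c u d m n ⟩
    c + (u * d + m) * n                        ∎)) (≋-+*n c (u * d + m)))
    where
    open ≡-Reasoning
    m = u * n' * X
    regroup : ∀ c u d n' X k1 w → c + u * d + u * n' * X * w + u * n' * (X * k1 + d) ≡ c + u * d * suc n' + u * n' * X * (k1 + w)
    regroup = solve-∀
    collect : ∀ c u d m n → c + u * d * n + m * n ≡ c + (u * d + m) * n
    collect = solve-∀

  Covers : Set
  Covers = CoversClasses E d

  jumps-to-col : ∀ j i → lookup E i ≡ suc j [mod d ] → ∃ λ m → j + m * w ≋ col i
  jumps-to-col j i same-class = by-order (≤-total j (col i)) (subst (_≡ suc j [mod d ]) (lookup-col i) same-class)
    where
    by-order : j ≤ col i ⊎ col i ≤ j → suc (col i) ≡ suc j [mod d ] → ∃ λ m → j + m * w ≋ col i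
    by-order (inj₁ j≤c) dv with ∣∸⇒≡+* j≤c (subst (d ∣ℕ_) (∣⁺a-⁺b∣-≥ (suc (col i)) (suc j) (s≤s j≤c)) dv)
    ... | u , c≡ with forward-by-d j u
    ... | m , fwd = m , ≋-trans fwd (≡⇒≋ (sym c≡))
    by-order (inj₂ c≤j) dv with ∣∸⇒≡+* c≤j (subst (d ∣ℕ_) (∣⁺a-⁺b∣-≤ (suc (col i)) (suc j) (s≤s c≤j)) dv)
    ... | u , j≡ with backward-by-d (col i) u
    ... | m , bwd = m , ≋-trans (≡⇒≋ (cong (_+ m * w) j≡)) bwd

  jumps-meet : Covers → ∀ j → j < n → ∃ λ m → isMinusCol ((j + suc m * w) % n) ≡ true
  jumps-meet cov j _ = meet (index (cov (suc j))) (jumps-to-col j (index (cov (suc j))) (lookup-index (cov (suc j))))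
    where
    regroup : ∀ j n m w → j + (n + m) * w ≡ j + m * w + w * n
    regroup = solve-∀
    meet : ∀ i → ∃ (λ m → j + m * w ≋ col i) → ∃ λ m → isMinusCol ((j + suc m * w) % n) ≡ true
    meet i (m , arrive) = n' + m , trans (isMinusCol-cong (≋-trans (≋-% (j + suc (n' + m) * w))
      (≋-trans (≡⇒≋ (regroup j n m w)) (≋-trans (≋-+*n (j + m * w) w) arrive)))) (col-minus i)

  -- Necessity of coverage: on an uncovered class the jumps never meet a minus
  -- column, so a level-0 cell there never leaves level 0.

  class-of-% : ∀ x → suc (x % n) % d ≡ suc x % d
  class-of-% x = trans (%-distribˡ-+ 1 (x % n) d)
    (trans (cong (λ z → (1 % d + z) % d) (m∣n⇒o%n%m≡o%m d n x d∣n)) (sym (%-distribˡ-+ 1 x d)))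

  class-of-jump : ∀ j → suc ((j + w) % n) % d ≡ suc j % d
  class-of-jump j = trans (class-of-% (j + w)) (%-remove-+ʳ (suc j) d∣w)

  trapped : ∀ r → ¬ Any (λ e → e ≡ r [mod d ]) E → ∀ j → suc j % d ≡ r % d →
    ∀ m → ∃ λ j' → iter step m (j , 0) ≡ (j' , 0) × suc j' % d ≡ r % d
  trapped r uncovered j inv zero = j , refl , inv
  trapped r uncovered j inv (suc m) with trapped r uncovered j inv m
  ... | j' , e , inv' = (j' + w) % n , trans (cong step e) (landing-plus ((j' + w) % n) k2 0 no-minus) , trans (class-of-jump j') inv'
    where
    no-minus : isMinusCol ((j' + w) % n) ≡ false
    no-minus with isMinusCol ((j' + w) % n) in e
    ... | false = refl
    ... | true with minus⇒col _ (%<n (j' + w)) e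
    ... | i , ci = ⊥-elim (uncovered (lose (∈-lookup i) (≡%⇒≡[mod] d (lookup E i) r
                    (trans (cong (_% d) (trans (lookup-col i) (cong suc ci))) (trans (class-of-jump j') inv')))))

  -- the level-0 cell in column r-1 cannot reach the level-1 cell above it
  connected⇒covers : Connected → Covers
  connected⇒covers conn r with any? (λ e → d ∣? ∣ ⁺ e -ℤ ⁺ r ∣) E
  ... | yes covered  = covered
  ... | no uncovered = ⊥-elim (escape (conn (j0 , 0) (j0 , 1) (%<n (r + n') , s≤s z≤n) (%<n (r + n') , s≤s (s≤s z≤n))))
    where
    j0 = (r + n') % n
    class-j0 : suc j0 % d ≡ r % d
    class-j0 = trans (class-of-% (r + n')) (trans (cong (_% d) (sym (+-suc r n'))) (%-remove-+ʳ r d∣n))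
    escape : ¬ Reaches step (j0 , 0) (j0 , 1)
    escape (m , e) with trapped r uncovered j0 class-j0 m
    ... | j' , e' , _ with () ← trans (sym e') e

  -- Necessity of the cycle condition: along an orbit the hubs are met in
  -- the order given by g.

  hubs-follow-g : ∀ m i i' → iter step m (col i , 0) ≡ (col i' , 0) → Reaches g i i'
  hubs-follow-g m i i' = go (suc m) m i ≤-refl
    where
    go : ∀ B m i → m < B → iter step m (col i , 0) ≡ (col i' , 0) → Reaches g i i'
    go (suc B) zero    i _         e = 0 , col-injective i i' (cong proj₁ e)
    go (suc B) (suc m) i (s≤s m≤B) e with hub-step i
    ... | r , 1≤r , er , off with suc m <? r
    ... | yes before = ⊥-elim (true≢false (trans (sym (col-minus i')) (subst NotHub e (off (suc m) (s≤s z≤n) before))))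
    ... | no after with go B (suc m ∸ r) (g i) (<-≤-trans (∸-monoʳ-< {o = 0} 1≤r (≮⇒≥ after)) m≤B)
          (trans (sym (trans (cong (λ z → iter step z (col i , 0)) (sym (m∸n+n≡m (≮⇒≥ after))))
                      (trans (iter-+ step (suc m ∸ r) r (col i , 0)) (cong (iter step (suc m ∸ r)) er)))) e)
    ... | q , eq = suc q , trans (iter-suc-inner g q i) eq

  connected⇒cycle : Connected → IsFullCycle g
  connected⇒cycle conn i i' with conn (col i , 0) (col i' , 0) (col<n i , s≤s z≤n) (col<n i' , s≤s z≤n)
  ... | m , e = hubs-follow-g m i i' e

  g-reaches : ∀ q i → Reaches step (col i , 0) (col (iter g q i) , 0)
  g-reaches zero    i = 0 , refl
  g-reaches (suc q) i with hub-step (iter g q i)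
  ... | r , _ , er , _ = reaches-trans (g-reaches q i) (r , er)

  -- the class of 0 is covered, so there is a minus column
  covers⇒reach-hub : Covers → ∀ {s} → Valid s → ReachesHub s
  covers⇒reach-hub cov = ReachHub.reach-hub (col i0) (col<n i0) (col-minus i0) (jumps-meet cov)
    where
    i0 = index (cov 0)

  covers-cycle⇒connected : Covers → IsFullCycle g → Connected
  covers-cycle⇒connected cov cyc s s' v v' = connect (covers⇒reach-hub cov v) (covers⇒reach-hub cov v')
    where
    connect : ReachesHub s → ReachesHub s' → Reaches step s s'
    connect (i , r) (i' , r') = reaches-trans (reaches-trans r hubs) (reaches-sym v' r')
      where
      hubs : Reaches step (col i , 0) (col i' , 0)
      hubs = subst (λ z → Reaches step (col i , 0) (col z , 0)) (proj₂ (cyc i i')) (g-reaches (proj₁ (cyc i i')) i)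

  characterisation : IsSolution A (allPlus n) C ⇔ (Covers × IsFullCycle (ω₂ k E ∘ ω₁ n k E))
  characterisation = mk⇔
    (λ sol → connected⇒covers (solution⇒connected sol) , subst IsFullCycle g-definition (connected⇒cycle (solution⇒connected sol)))
    (λ (cov , cyc) → connected⇒solution (covers-cycle⇒connected cov (subst IsFullCycle (sym g-definition) cyc)))

odd-decomposition : ∀ k n → 3 ≤ k → k % 2 ≡ 1 → k < n →
  ∃ λ h → ∃ λ p → k ≡ suc (suc (suc (h + h))) × n ≡ suc (suc (suc (h + h))) + suc p
odd-decomposition k n 3≤k odd k<n with k / 2 in half
... | zero = ⊥-elim (<⇒≱ (s≤s (s≤s z≤n)) (subst (3 ≤_) k≡1 3≤k))
  where
  k≡1 : k ≡ 1
  k≡1 = trans (m≡m%n+[m/n]*n k 2) (cong₂ (λ a b → a + b * 2) odd half)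
... | suc h = h , n ∸ suc k , k≡ , n≡
  where
  k≡ : k ≡ suc (suc (suc (h + h)))
  k≡ = trans (m≡m%n+[m/n]*n k 2) (trans (cong₂ (λ a b → a + b * 2) odd half)
         (cong (λ z → suc (suc (suc z))) (trans (*-comm h 2) (cong (h +_) (+-identityʳ h)))))
  n≡ : n ≡ suc (suc (suc (h + h))) + suc (n ∸ suc k)
  n≡ = trans (sym (m+[n∸m]≡n k<n)) (trans (cong (λ z → suc z + (n ∸ suc k)) k≡) (sym (+-suc (suc (suc (suc (h + h)))) (n ∸ suc k))))

lemma4p9 : (k n : ℕ) .{{_ : NonZero n}} → 3 ≤ k → k % 2 ≡ 1 → k < n →
    (C : Fin n → Sign) →
    IsSolution (stdDiagArray n k) (allPlus n) C
      ⇔ (CoversClasses (minusPositions C) (gcd n (k ∸ 1))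
         × IsFullCycle (ω₂ k (minusPositions C) ∘ ω₁ n k (minusPositions C)))
lemma4p9 k n 3≤k odd k<n C with odd-decomposition k n 3≤k odd k<n
... | h , p , refl , refl = Dynamics.characterisation h p C
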